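{- (i) Let $P>0$ be an integer with $P^2-4\neq 0$, and let $n$ be a Lucas pseudoprime with parameters $P$ and $Q=1$. Let $\widetilde{x}, \widetilde{y}$ be integers with $\widetilde{x} \equiv 2^{ -1}P \pmod n$ and $\widetilde{y} \equiv 2^{ -1} \pmod n$. Then $n$ is a Pell pseudoprime with parameters $D = P^2-4$ and $(\widetilde{x}, \widetilde{y})$. (ii) Conversely, let $D$ be an integer and let $n$ be a Pell pseudoprime with parameters $D$ and $(\widetilde{x}, \widetilde{y})$, where $\widetilde{x},\widetilde{y}$ are integers. Then $n$ is a Lucas pseudoprime with parameters $P = 2\widetilde{x}$ and $Q = 1$.
   Context: For integers $P, Q$, the Lucas sequence $(U_k(P,Q))_{k\ge0}$ is defined by $U_0 = 0$, $U_1 = 1$, $U_k = PU_{k-1} - QU_{k-2}$ for $k\ge 2$. For an odd integer $n$, $\big(\tfrac{D}{n}\big)$ denotes the Jacobi symbol. An odd composite integer $n$ with $\gcd(n,Q)=1$ is a Lucas pseudoprime with parameters $P, Q$ if $U_{n - (D/n)}(P,Q) \equiv 0 \pmod n$, where $D = P^2 - 4Q$ (the paper's standing convention for Lucas sequences is $P>0$ and $P^2-4Q\neq 0$). For an integer $D$ and pairs of integers, the Brahmagupta product is $(x_1,y_1)\otimes_D (x_2,y_2) := (x_1x_2 + Dy_1y_2,\ x_1y_2 + x_2y_1)$, with powers $(x,y)^{\otimes 0} = (1,0)$, $(x,y)^{\otimes(k+1)} = (x,y)^{\otimes k}\otimes_D(x,y)$. The Pell conic over $\mathbb{Z}_n=\mathbb{Z}/n\mathbb{Z}$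 is $\mathcal{C}_D(\mathbb{Z}_n) = \{(x,y)\in\mathbb{Z}_n^2 : x^2 - Dy^2 = 1\}$. An odd composite integer $n$ is a Pell pseudoprime with parameters $D$ and $(\widetilde{x},\widetilde{y})$ if $(\widetilde{x}\bmod n, \widetilde{y}\bmod n)\in \mathcal{C}_D(\mathbb{Z}_n)$ (i.e. $\widetilde{x}^2 - D\widetilde{y}^2\equiv 1 \pmod n$), $\gcd(n,\widetilde{y}) = 1$, and $y_n \equiv 0 \pmod n$, where $(x_n, y_n) = (\widetilde{x},\widetilde{y})^{\otimes (n - (D/n))}$ computed with $\otimes_D$. -}

module Defs where

open import Data.Bool using (Bool; true; false; if_then_else_)
open import Data.Nat as ℕ using (ℕ; zero; suc; _≡ᵇ_; _≤ᵇ_)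
open import Data.Nat.Divisibility as ℕD using (_∣?_)
open import Data.Nat.Primality using (Composite)
open import Data.Integer as ℤ using (ℤ; +_; _-_; _*_; _+_; ∣_∣; _%ℕ_)
open import Data.Integer.Divisibility using (_∣_)
open import Data.Integer.GCD using (gcd)
open import Data.List using (upTo)
open import Data.Bool.ListAction using (any)
open import Data.Product using (_×_; _,_; proj₁; proj₂)
open import Relation.Nullary using (does)
open import Relation.Binary.PropositionalEquality using (_≡_)

Cong : ℕ → ℤ → ℤ → Set
Cong n a b = (+ n) ∣ (a - b)

Odd : ℕ → Set
Odd n = n ℕ.% 2 ≡ 1

-- Jacobi symbol (a / n) for odd n ≥ 1, defined as the product of
-- Legendre symbols over the prime factorisation of n.

legendre : ℤ → ℕ → ℤ
legendre a zero = + 0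
legendre a (suc k) =
  let r = a %ℕ (suc k) in
  if r ≡ᵇ 0 then + 0
  else if any (λ x → ((x ℕ.* x) ℕ.% (suc k)) ≡ᵇ r) (upTo (suc k)) then + 1
  else ℤ.-[1+ 0 ]

-- first divisor of n among d, d+1, ..., d+fuel-1 (n if none)
findDiv : ℕ → ℕ → ℕ → ℕ
findDiv zero d n = n
findDiv (suc f) d n = if does (d ∣? n) then d else findDiv f (suc d) n

minFactor : ℕ → ℕ
minFactor n = findDiv n 2 n

jacobiAux : ℕ → ℤ → ℕ → ℤ
jacobiAux zero a n = + 1
jacobiAux (suc f) a n with n ≤ᵇ 1 | minFactor n
... | true  | _ = + 1
... | false | zero = + 1
... | false | suc k = legendre a (suc k) * jacobiAux f a (n ℕ./ suc k)

jacobi : ℤ → ℕ → ℤ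
jacobi a n = jacobiAux n a n

idx : ℤ → ℕ → ℕ
idx D n = ∣ + n - jacobi D n ∣

U : ℤ → ℤ → ℕ → ℤ
U P Q zero = + 0
U P Q (suc zero) = + 1
U P Q (suc (suc k)) = P * U P Q (suc k) - Q * U P Q k

LucasPseudoprime : ℤ → ℤ → ℕ → Set
LucasPseudoprime P Q n =
  Odd n × Composite n × gcd (+ n) Q ≡ + 1 ×
  Cong n (U P Q (idx (P * P - (+ 4) * Q) n)) (+ 0)

brahma : ℤ → ℤ × ℤ → ℤ × ℤ → ℤ × ℤ
brahma D (x₁ , y₁) (x₂ , y₂) = (x₁ * x₂ + D * y₁ * y₂ , x₁ * y₂ + x₂ * y₁)

bpow : ℤ → ℤ × ℤ → ℕ → ℤ × ℤ
bpow D p zero = (+ 1 , + 0)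
bpow D p (suc k) = brahma D (bpow D p k) p

PellPseudoprime : ℤ → ℤ → ℤ → ℕ → Set
PellPseudoprime D x y n =
  Odd n × Composite n ×
  Cong n (x * x - D * y * y) (+ 1) ×
  gcd (+ n) y ≡ + 1 ×
  Cong n (proj₂ (bpow D (x , y) (idx D n))) (+ 0)

{-# OPTIONS --safe #-}
module Submission where

-- Since x + y√D is a root of t² − 2x t + N with N = x² − D y², the y-coordinate of the
-- Brahmagupta power (x, y)ᵏ is y · Uₖ(2x, N).  In (i), 2x ≡ P and 2y ≡ 1 force N ≡ 1, so
-- Uₖ(2x, N) ≡ Uₖ(P, 1) ≡ 0; in (ii), N ≡ 1 and y is a unit modulo n, so y Uₖ(2x, N) ≡ 0
-- gives Uₖ(2x, 1) ≡ 0.  The two indices n − (D/n) agree because the Lucas discriminant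
-- (2x)² − 4 is congruent to (2y)² D, and the Jacobi symbol is blind to squares of units.

open import Defs
open import Data.Bool using (Bool; true; false; T; if_then_else_)
open import Data.Bool.Properties using (T-≡; ⇔→≡)
open import Data.Bool.ListAction using (any)
open import Data.List using (upTo)
open import Data.List.Membership.Propositional using (find; lose)
open import Data.List.Membership.Propositional.Properties using (∈-upTo⁺)
open import Data.List.Relation.Unary.Any.Properties using (any⁺; any⁻)
open import Data.Nat as ℕ using (ℕ; zero; suc; _≡ᵇ_; _≤ᵇ_)
import Data.Nat.Properties as ℕ
import Data.Nat.Divisibility as ℕ
open import Data.Nat.DivMod using (m≡m%n+[m/n]*n; m<n⇒m%n≡m; [m+kn]%n≡m%n)
open import Data.Nat.GCD using (module Bézout)
import Data.Nat.Coprimality as ℕ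
open import Data.Integer using (ℤ; +_; -[1+_]; _+_; _-_; -_; _*_; _<_; ∣_∣; _%ℕ_; _/ℕ_)
import Data.Integer.Properties as ℤ
open import Data.Integer.Coprimality using (Coprime)
open import Data.Integer.Divisibility.Signed as Signed
  using (∣ᵤ⇒∣; ∣⇒∣ᵤ; divides; ∣m∣n⇒∣m-n; ∣m⇒∣m*n; ∣n⇒∣m*n)
open import Data.Integer.DivMod using (a≡a%ℕn+[a/ℕn]*n; n%ℕd<d)
open import Data.Integer.GCD using (gcd; gcd-zeroʳ)
open import Data.Integer.Tactic.RingSolver using (solve-∀)
open import Data.Product using (_×_; ∃; _,_; proj₂)
open import Function using (_⇔_; mk⇔)
open import Function.Properties.Equivalence using () renaming (trans to ⇔-trans; sym to ⇔-sym)
open import Level using (0ℓ)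
open import Relation.Nullary using (yes; no)
open import Relation.Binary using (Setoid; IsEquivalence)
import Relation.Binary.Reasoning.Setoid as SetoidReasoning
open import Relation.Binary.PropositionalEquality
  using (_≡_; _≢_; refl; sym; trans; cong; cong₂; subst; module ≡-Reasoning)

pos-+-* : ∀ a b c → + (a ℕ.+ b ℕ.* c) ≡ + a + + b * + c
pos-+-* a b c = trans (ℤ.pos-+ a (b ℕ.* c)) (cong (_+_ (+ a)) (ℤ.pos-* b c))

-- Congruence with an explicit quotient, so that its algebra reduces to ring identities;
-- fromCong and toCong translate to and from the divisibility form Cong of the statement.
infix 4 _≡_mod_
record _≡_mod_ (a b : ℤ) (n : ℕ) : Set where
  constructor witness
  field
    quotient : ℤ
    equation : a ≡ b + quotient * + n

module _ {n : ℕ} where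

  ≡mod-reflexive : ∀ {a b} → a ≡ b → a ≡ b mod n
  ≡mod-reflexive {a} refl = witness (+ 0) (sym (ℤ.+-identityʳ a))

  ≡mod-refl : ∀ {a} → a ≡ a mod n
  ≡mod-refl = ≡mod-reflexive refl

  ≡mod-sym : ∀ {a b} → a ≡ b mod n → b ≡ a mod n
  ≡mod-sym {b = b} (witness q refl) = witness (- q) (identity b q (+ n))
    where identity : ∀ b q n → b ≡ b + q * n + - q * n
          identity = solve-∀

  ≡mod-trans : ∀ {a b c} → a ≡ b mod n → b ≡ c mod n → a ≡ c mod n
  ≡mod-trans {c = c} (witness q refl) (witness r refl) = witness (r + q) (identity c q r (+ n))
    where identity : ∀ c q r n → c + r * n + q * n ≡ c + (r + q) * n
          identity = solve-∀

  +-cong : ∀ {a b c d} → a ≡ b mod n → c ≡ d mod n → a + c ≡ b + d mod n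
  +-cong {b = b} {d = d} (witness q refl) (witness r refl) =
    witness (q + r) (identity b d q r (+ n))
    where identity : ∀ b d q r n → b + q * n + (d + r * n) ≡ b + d + (q + r) * n
          identity = solve-∀

  -cong : ∀ {a b c d} → a ≡ b mod n → c ≡ d mod n → a - c ≡ b - d mod n
  -cong {b = b} {d = d} (witness q refl) (witness r refl) = witness (q - r) (identity b d q r (+ n))
    where identity : ∀ b d q r n → b + q * n - (d + r * n) ≡ b - d + (q - r) * n
          identity = solve-∀

  *-cong : ∀ {a b c d} → a ≡ b mod n → c ≡ d mod n → a * c ≡ b * d mod n
  *-cong {b = b} {d = d} (witness q refl) (witness r refl) =
    witness (q * d + b * r + q * r * + n) (identity b d q r (+ n))
    where identity : ∀ b d q r n →
                     (b + q * n) * (d + r * n) ≡ b * d + (q * d + b * r + q * r * n) * n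
          identity = solve-∀

  *-congˡ : ∀ a {b c} → b ≡ c mod n → a * b ≡ a * c mod n
  *-congˡ a = *-cong (≡mod-refl {a})

  ≡mod-isEquivalence : IsEquivalence (_≡_mod n)
  ≡mod-isEquivalence = record { refl = ≡mod-refl ; sym = ≡mod-sym ; trans = ≡mod-trans }

≡mod-setoid : ℕ → Setoid 0ℓ 0ℓ
≡mod-setoid n = record { Carrier = ℤ ; _≈_ = (_≡_mod n) ; isEquivalence = ≡mod-isEquivalence }

module ≡mod-Reasoning (n : ℕ) = SetoidReasoning (≡mod-setoid n)

fromCong : ∀ {n a b} → Cong n a b → a ≡ b mod n
fromCong {n} {a} {b} n∣a-b with ∣ᵤ⇒∣ n∣a-b
... | divides q eq = witness q (trans (identity a b) (cong (_+_ b) eq))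
  where identity : ∀ a b → a ≡ b + (a - b)
        identity = solve-∀

toCong : ∀ {n a b} → a ≡ b mod n → Cong n a b
toCong {n} {b = b} (witness q refl) = ∣⇒∣ᵤ (divides q (identity b q (+ n)))
  where identity : ∀ b q n → b + q * n - b ≡ q * n
        identity = solve-∀

≡mod-∣ : ∀ {m n a b} → m ℕ.∣ n → a ≡ b mod n → a ≡ b mod m
≡mod-∣ {m} {b = b} (ℕ.divides c n≡c*m) (witness q refl) =
  witness (q * + c) (trans (cong (λ t → b + q * t) (trans (cong +_ n≡c*m) (ℤ.pos-* c m)))
                           (identity b q (+ c) (+ m)))
  where identity : ∀ b q c m → b + q * (c * m) ≡ b + q * c * m
        identity = solve-∀

*-cancelˡ-unit : ∀ {n} u w {a b} → u * w ≡ + 1 mod n → u * a ≡ u * b mod n → a ≡ b mod n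
*-cancelˡ-unit {n} u w {a} {b} uw≡1 ua≡ub = begin
  a             ≡⟨ ℤ.*-identityˡ a ⟨
  + 1 * a       ≈⟨ *-cong uw≡1 ≡mod-refl ⟨
  u * w * a     ≡⟨ reassoc u w a ⟩
  w * (u * a)   ≈⟨ *-congˡ w ua≡ub ⟩
  w * (u * b)   ≡⟨ reassoc u w b ⟨
  u * w * b     ≈⟨ *-cong uw≡1 ≡mod-refl ⟩
  + 1 * b       ≡⟨ ℤ.*-identityˡ b ⟩
  b             ∎
  where
    open ≡mod-Reasoning n
    reassoc : ∀ u w a → u * w * a ≡ w * (u * a)
    reassoc = solve-∀

*-unit : ∀ {n} u w u′ w′ → u * w ≡ + 1 mod n → u′ * w′ ≡ + 1 mod n →
         (u * u′) * (w * w′) ≡ + 1 mod n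
*-unit {n} u w u′ w′ uw≡1 u′w′≡1 = begin
  (u * u′) * (w * w′)  ≡⟨ reassoc u u′ w w′ ⟩
  (u * w) * (u′ * w′)  ≈⟨ *-cong uw≡1 u′w′≡1 ⟩
  + 1 * + 1            ∎
  where
    open ≡mod-Reasoning n
    reassoc : ∀ u u′ w w′ → (u * u′) * (w * w′) ≡ (u * w) * (u′ * w′)
    reassoc = solve-∀

odd⇒2-unit : ∀ {n} → Odd n → + 2 * (+ (n ℕ./ 2) + + 1) ≡ + 1 mod n
odd⇒2-unit {n} odd =
  witness (+ 1) (trans (identity (+ (n ℕ./ 2))) (cong (λ t → + 1 + + 1 * t) (sym n≡1+2h)))
  where
    n≡1+2h : + n ≡ + 1 + + (n ℕ./ 2) * + 2
    n≡1+2h = trans (cong +_ (trans (m≡m%n+[m/n]*n n 2) (cong (ℕ._+ (n ℕ./ 2) ℕ.* 2) odd)))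
                   (pos-+-* 1 (n ℕ./ 2) 2)
    identity : ∀ h → + 2 * (h + + 1) ≡ + 1 + + 1 * (+ 1 + h * + 2)
    identity = solve-∀

unit⇒coprime : ∀ {n} y w → y * w ≡ + 1 mod n → Coprime (+ n) y
unit⇒coprime {n} y w (witness q yw≡1+qn) {d} (d∣n , d∣y) =
  ℕ.∣1⇒≡1 (∣⇒∣ᵤ (subst (+ d Signed.∣_) cancel
    (∣m∣n⇒∣m-n (∣m⇒∣m*n w (∣ᵤ⇒∣ {+ d} {y} d∣y)) (∣n⇒∣m*n q (∣ᵤ⇒∣ {+ d} {+ n} d∣n)))))
  where
    cancel : y * w - q * + n ≡ + 1
    cancel = trans (cong (_- q * + n) yw≡1+qn) (identity q (+ n))
      where identity : ∀ q n → + 1 + q * n - q * n ≡ + 1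
            identity = solve-∀

coprime⇒unit : ∀ {n} y → Coprime (+ n) y → ∃ λ w → y * w ≡ + 1 mod n
coprime⇒unit {n} y c = sign-free y (abs-unit (ℕ.coprime-Bézout c))
  where
    abs-unit : Bézout.Identity 1 n ∣ y ∣ → ∃ λ w → + ∣ y ∣ * w ≡ + 1 mod n
    abs-unit (Bézout.+- a b 1+b∣y∣≡an) = - + b , witness (- + a) (begin
      + ∣ y ∣ * - + b               ≡⟨ negate (+ ∣ y ∣) (+ b) ⟩
      + 1 - (+ 1 + + b * + ∣ y ∣)   ≡⟨ cong (λ t → + 1 - t) (sym (pos-+-* 1 b ∣ y ∣)) ⟩
      + 1 - + (1 ℕ.+ b ℕ.* ∣ y ∣)   ≡⟨ cong (λ t → + 1 - + t) 1+b∣y∣≡an ⟩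
      + 1 - + (a ℕ.* n)             ≡⟨ cong (λ t → + 1 - t) (ℤ.pos-* a n) ⟩
      + 1 - + a * + n               ≡⟨ negate′ (+ a) (+ n) ⟩
      + 1 + - + a * + n             ∎)
      where
        open ≡-Reasoning
        negate : ∀ m b → m * - b ≡ + 1 - (+ 1 + b * m)
        negate = solve-∀
        negate′ : ∀ a n → + 1 - a * n ≡ + 1 + - a * n
        negate′ = solve-∀
    abs-unit (Bézout.-+ a b 1+an≡b∣y∣) = + b , witness (+ a) (begin
      + ∣ y ∣ * + b         ≡⟨ ℤ.*-comm (+ ∣ y ∣) (+ b) ⟩
      + b * + ∣ y ∣         ≡⟨ ℤ.pos-* b ∣ y ∣ ⟨
      + (b ℕ.* ∣ y ∣)       ≡⟨ cong +_ 1+an≡b∣y∣ ⟨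
      + (1 ℕ.+ a ℕ.* n)     ≡⟨ pos-+-* 1 a n ⟩
      + 1 + + a * + n       ∎)
      where open ≡-Reasoning
    sign-free : ∀ y → (∃ λ w → + ∣ y ∣ * w ≡ + 1 mod n) → ∃ λ w → y * w ≡ + 1 mod n
    sign-free (+ m) unit = unit
    sign-free -[1+ m ] (w , witness q eq) = - w , witness q (trans (neg*neg (+ suc m) w) eq)
      where neg*neg : ∀ a w → - a * - w ≡ a * w
            neg*neg = solve-∀

gcd≡1⇒unit : ∀ {n} y → gcd (+ n) y ≡ + 1 → ∃ λ w → y * w ≡ + 1 mod n
gcd≡1⇒unit y g≡1 = coprime⇒unit y (ℕ.gcd≡1⇒coprime (ℤ.+-injective g≡1))

unit⇒gcd≡1 : ∀ {n} y w → y * w ≡ + 1 mod n → gcd (+ n) y ≡ + 1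
unit⇒gcd≡1 y w yw≡1 = cong +_ (ℕ.coprime⇒gcd≡1 (unit⇒coprime y w yw≡1))

residue-unique⁺ : ∀ {d r s} .{{_ : ℕ.NonZero d}} m → r ℕ.< d → s ℕ.< d →
                  + r ≡ + s + + m * + d → r ≡ s
residue-unique⁺ {d} {r} {s} m r<d s<d r≡s+md = begin
  r                      ≡⟨ m<n⇒m%n≡m r<d ⟨
  r ℕ.% d                ≡⟨ cong (ℕ._% d) (ℤ.+-injective (trans r≡s+md (sym (pos-+-* s m d)))) ⟩
  (s ℕ.+ m ℕ.* d) ℕ.% d  ≡⟨ [m+kn]%n≡m%n s m d ⟩
  s ℕ.% d                ≡⟨ m<n⇒m%n≡m s<d ⟩
  s                      ∎
  where open ≡-Reasoning

residue-unique : ∀ {d r s} .{{_ : ℕ.NonZero d}} → r ℕ.< d → s ℕ.< d → + r ≡ + s mod d → r ≡ s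
residue-unique r<d s<d (witness (+ m) r≡s+md) = residue-unique⁺ m r<d s<d r≡s+md
residue-unique {d} {r} {s} r<d s<d (witness -[1+ m ] r≡s-md) =
  sym (residue-unique⁺ (suc m) s<d r<d
    (trans (identity (+ s) (+ suc m) (+ d)) (cong (_+ + suc m * + d) (sym r≡s-md))))
  where identity : ∀ s c d → s ≡ s + - c * d + c * d
        identity = solve-∀

≡mod-%ℕ : ∀ d .{{_ : ℕ.NonZero d}} a → a ≡ + (a %ℕ d) mod d
≡mod-%ℕ d a = witness (a /ℕ d) (a≡a%ℕn+[a/ℕn]*n a d)

%ℕ-cong : ∀ {d a b} .{{_ : ℕ.NonZero d}} → a ≡ b mod d → a %ℕ d ≡ b %ℕ d
%ℕ-cong {d} {a} {b} a≡b = residue-unique (n%ℕd<d a d) (n%ℕd<d b d)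
  (≡mod-trans (≡mod-sym (≡mod-%ℕ d a)) (≡mod-trans a≡b (≡mod-%ℕ d b)))

IsSquareMod : ℕ → ℤ → Set
IsSquareMod n a = ∃ λ z → z * z ≡ a mod n

module _ {n : ℕ} (u w : ℤ) (uw≡1 : u * w ≡ + 1 mod n) where

  zero-unit-square : ∀ a → u * u * a ≡ + 0 mod n ⇔ a ≡ + 0 mod n
  zero-unit-square a = mk⇔ to from
    where
      to : u * u * a ≡ + 0 mod n → a ≡ + 0 mod n
      to uua≡0 = *-cancelˡ-unit (u * u) (w * w) (*-unit u w u w uw≡1 uw≡1)
        (≡mod-trans uua≡0 (≡mod-reflexive (sym (ℤ.*-zeroʳ (u * u)))))
      from : a ≡ + 0 mod n → u * u * a ≡ + 0 mod n
      from a≡0 = ≡mod-trans (*-congˡ (u * u) a≡0) (≡mod-reflexive (ℤ.*-zeroʳ (u * u)))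

  square-unit-square : ∀ a → IsSquareMod n (u * u * a) ⇔ IsSquareMod n a
  square-unit-square a = mk⇔ to from
    where
      open ≡mod-Reasoning n
      to : IsSquareMod n (u * u * a) → IsSquareMod n a
      to (z , zz≡uua) = w * z , (begin
        (w * z) * (w * z)        ≡⟨ regroup w z ⟩
        w * w * (z * z)          ≈⟨ *-congˡ (w * w) zz≡uua ⟩
        w * w * (u * u * a)      ≡⟨ regroup′ u w a ⟩
        (u * u) * (w * w) * a    ≈⟨ *-cong (*-unit u w u w uw≡1 uw≡1) ≡mod-refl ⟩
        + 1 * a                  ≡⟨ ℤ.*-identityˡ a ⟩
        a                        ∎)
        where
          regroup : ∀ w z → (w * z) * (w * z) ≡ w * w * (z * z)
          regroup = solve-∀
          regroup′ : ∀ u w a → w * w * (u * u * a) ≡ (u * u) * (w * w) * a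
          regroup′ = solve-∀
      from : IsSquareMod n a → IsSquareMod n (u * u * a)
      from (z , zz≡a) = u * z , (begin
        (u * z) * (u * z)   ≡⟨ regroup u z ⟩
        u * u * (z * z)     ≈⟨ *-congˡ (u * u) zz≡a ⟩
        u * u * a           ∎)
        where
          regroup : ∀ u z → (u * z) * (u * z) ≡ u * u * (z * z)
          regroup = solve-∀

T-injective : ∀ {p q} → T p ⇔ T q → p ≡ q
T-injective Tp⇔Tq = ⇔→≡ (⇔-trans (⇔-sym T-≡) (⇔-trans Tp⇔Tq T-≡))

module _ (k : ℕ) where

  isSquareRootᵇ : ℤ → ℕ → Bool
  isSquareRootᵇ a x = ((x ℕ.* x) ℕ.% suc k) ≡ᵇ a %ℕ suc k

  zero-test : ∀ a → T (a %ℕ suc k ≡ᵇ 0) ⇔ a ≡ + 0 mod suc k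
  zero-test a = mk⇔ to from
    where
      to : T (a %ℕ suc k ≡ᵇ 0) → a ≡ + 0 mod suc k
      to t = ≡mod-trans (≡mod-%ℕ (suc k) a) (≡mod-reflexive (cong +_ (ℕ.≡ᵇ⇒≡ _ 0 t)))
      from : a ≡ + 0 mod suc k → T (a %ℕ suc k ≡ᵇ 0)
      from a≡0 = ℕ.≡⇒≡ᵇ _ 0 (%ℕ-cong a≡0)

  square-test : ∀ a →
    T (any (isSquareRootᵇ a) (upTo (suc k))) ⇔ IsSquareMod (suc k) a
  square-test a = mk⇔ to from
    where
      to : T (any (isSquareRootᵇ a) (upTo (suc k))) → IsSquareMod (suc k) a
      to t with find (any⁻ (isSquareRootᵇ a) (upTo (suc k)) t)
      ... | x , _ , x²≡a = + x , (begin
        + x * + x                  ≡⟨ ℤ.pos-* x x ⟨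
        + (x ℕ.* x)                ≈⟨ ≡mod-%ℕ (suc k) (+ (x ℕ.* x)) ⟩
        + ((x ℕ.* x) ℕ.% suc k)    ≡⟨ cong +_ (ℕ.≡ᵇ⇒≡ _ _ x²≡a) ⟩
        + (a %ℕ suc k)             ≈⟨ ≡mod-%ℕ (suc k) a ⟨
        a                          ∎)
        where open ≡mod-Reasoning (suc k)
      from : IsSquareMod (suc k) a → T (any (isSquareRootᵇ a) (upTo (suc k)))
      from (z , z²≡a) =
        any⁺ (isSquareRootᵇ a) (lose (∈-upTo⁺ (n%ℕd<d z (suc k))) (ℕ.≡⇒≡ᵇ _ _ (%ℕ-cong r²≡a)))
        where
          open ≡mod-Reasoning (suc k)
          r = z %ℕ suc k
          r²≡a : + (r ℕ.* r) ≡ a mod suc k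
          r²≡a = begin
            + (r ℕ.* r)   ≡⟨ ℤ.pos-* r r ⟩
            + r * + r     ≈⟨ *-cong (≡mod-%ℕ (suc k) z) (≡mod-%ℕ (suc k) z) ⟨
            z * z         ≈⟨ z²≡a ⟩
            a             ∎

  legendre-cong : ∀ {a b} → a ≡ b mod suc k → legendre a (suc k) ≡ legendre b (suc k)
  legendre-cong a≡b rewrite %ℕ-cong a≡b = refl

  legendre-unit-square : ∀ u w → u * w ≡ + 1 mod suc k → ∀ a →
                         legendre (u * u * a) (suc k) ≡ legendre a (suc k)
  legendre-unit-square u w uw≡1 a =
    -- legendre a (suc k) unfolds to this case split on the zero test and the square test
    cong₂ (λ zero? square? → if zero? then + 0 else if square? then + 1 else -[1+ 0 ])
      (T-injective (⇔-trans (zero-test _)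
                            (⇔-trans (zero-unit-square u w uw≡1 a) (⇔-sym (zero-test a)))))
      (T-injective (⇔-trans (square-test _)
                            (⇔-trans (square-unit-square u w uw≡1 a) (⇔-sym (square-test a)))))

findDiv-∣ : ∀ f d m → findDiv f d m ℕ.∣ m
findDiv-∣ zero d m = ℕ.∣-refl
findDiv-∣ (suc f) d m with d ℕ.∣? m
... | yes d∣m = d∣m
... | no _ = findDiv-∣ f (suc d) m

jacobiAux-cong : ∀ f {a b} m → (∀ e → e ℕ.∣ m → legendre a e ≡ legendre b e) →
                 jacobiAux f a m ≡ jacobiAux f b m
jacobiAux-cong zero m _ = refl
jacobiAux-cong (suc f) m agree with m ≤ᵇ 1 | minFactor m | findDiv-∣ m 2 m
... | true  | _     | _   = refl
... | false | zero  | _   = refl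
... | false | suc k | p∣m = cong₂ _*_ (agree (suc k) p∣m)
  (jacobiAux-cong f (m ℕ./ suc k) (λ e e∣m/p → agree e (ℕ.∣-trans e∣m/p (ℕ.m/n∣m p∣m))))

jacobi-unit-square : ∀ {n} u w {a b} → u * w ≡ + 1 mod n → a ≡ u * u * b mod n →
                     jacobi a n ≡ jacobi b n
jacobi-unit-square {n} u w {a} {b} uw≡1 a≡uub = jacobiAux-cong n n legendre-agrees
  where
    legendre-agrees : ∀ e → e ℕ.∣ n → legendre a e ≡ legendre b e
    legendre-agrees zero    _   = refl
    legendre-agrees (suc k) e∣n =
      trans (legendre-cong k (≡mod-∣ e∣n a≡uub)) (legendre-unit-square k u w (≡mod-∣ e∣n uw≡1) b)

U-cong : ∀ {n P P′ Q Q′} → P ≡ P′ mod n → Q ≡ Q′ mod n → ∀ k → U P Q k ≡ U P′ Q′ k mod n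
U-cong P≡P′ Q≡Q′ zero          = ≡mod-refl
U-cong P≡P′ Q≡Q′ (suc zero)    = ≡mod-refl
U-cong P≡P′ Q≡Q′ (suc (suc k)) =
  -cong (*-cong P≡P′ (U-cong P≡P′ Q≡Q′ (suc k))) (*-cong Q≡Q′ (U-cong P≡P′ Q≡Q′ k))

norm : ℤ → ℤ → ℤ → ℤ
norm D x y = x * x - D * y * y

bpow-lucas : ∀ D x y k → let V = U (+ 2 * x) (norm D x y) in
  bpow D (x , y) (suc k) ≡ (x * V (suc k) - norm D x y * V k , y * V (suc k))
bpow-lucas D x y zero = cong₂ _,_ (first D x y) (second x y)
  where
    first : ∀ D x y → + 1 * x + D * + 0 * y ≡ x * + 1 - (x * x - D * y * y) * + 0
    first = solve-∀
    second : ∀ x y → + 1 * y + x * + 0 ≡ y * + 1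
    second = solve-∀
bpow-lucas D x y (suc k) = trans (cong (λ p → brahma D p (x , y)) (bpow-lucas D x y k))
  (cong₂ _,_ (first D x y (V (suc k)) (V k)) (second D x y (V (suc k)) (V k)))
  where
    V = U (+ 2 * x) (norm D x y)
    first : ∀ D x y a b → (x * a - (x * x - D * y * y) * b) * x + D * (y * a) * y
            ≡ x * (+ 2 * x * a - (x * x - D * y * y) * b) - (x * x - D * y * y) * a
    first = solve-∀
    second : ∀ D x y a b → (x * a - (x * x - D * y * y) * b) * y + x * (y * a)
             ≡ y * (+ 2 * x * a - (x * x - D * y * y) * b)
    second = solve-∀

proj₂-bpow : ∀ D x y k → proj₂ (bpow D (x , y) k) ≡ y * U (+ 2 * x) (norm D x y) k
proj₂-bpow D x y zero    = sym (ℤ.*-zeroʳ y)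
proj₂-bpow D x y (suc k) = cong proj₂ (bpow-lucas D x y k)

halves-on-conic : ∀ {n} P x y → Odd n → + 2 * x ≡ P mod n → + 2 * y ≡ + 1 mod n →
                  norm (P * P - + 4) x y ≡ + 1 mod n
halves-on-conic {n} P x y odd 2x≡P 2y≡1 = *-cancelˡ-unit (+ 4) (h * h) 4-unit (begin
  + 4 * norm D x y                                     ≡⟨ expand P x y ⟩
  (+ 2 * x) * (+ 2 * x) - D * ((+ 2 * y) * (+ 2 * y))  ≈⟨ -cong (*-cong 2x≡P 2x≡P)
                                                                (*-congˡ D (*-cong 2y≡1 2y≡1)) ⟩
  P * P - D * (+ 1 * + 1)                              ≡⟨ collapse P ⟩
  + 4 * + 1                                            ∎)
  where
    open ≡mod-Reasoning n
    D = P * P - + 4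
    h = + (n ℕ./ 2) + + 1
    4-unit : (+ 2 * + 2) * (h * h) ≡ + 1 mod n
    4-unit = *-unit (+ 2) h (+ 2) h (odd⇒2-unit odd) (odd⇒2-unit odd)
    expand : ∀ P x y → + 4 * (x * x - (P * P - + 4) * y * y)
             ≡ (+ 2 * x) * (+ 2 * x) - (P * P - + 4) * ((+ 2 * y) * (+ 2 * y))
    expand = solve-∀
    collapse : ∀ P → P * P - (P * P - + 4) * (+ 1 * + 1) ≡ + 4 * + 1
    collapse = solve-∀

lucas-discriminant : ∀ {n} D x y → norm D x y ≡ + 1 mod n →
                     (+ 2 * x) * (+ 2 * x) - + 4 * + 1 ≡ (+ 2 * y) * (+ 2 * y) * D mod n
lucas-discriminant {n} D x y N≡1 = begin
  (+ 2 * x) * (+ 2 * x) - + 4 * + 1  ≡⟨ expand D x y ⟩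
  c + + 4 * norm D x y - + 4         ≈⟨ -cong (+-cong (≡mod-refl {a = c}) (*-congˡ (+ 4) N≡1))
                                              (≡mod-refl {a = + 4}) ⟩
  c + + 4 * + 1 - + 4                ≡⟨ cancel c ⟩
  c                                  ∎
  where
    open ≡mod-Reasoning n
    c = (+ 2 * y) * (+ 2 * y) * D
    expand : ∀ D x y → (+ 2 * x) * (+ 2 * x) - + 4 * + 1
             ≡ (+ 2 * y) * (+ 2 * y) * D + + 4 * (x * x - D * y * y) - + 4
    expand = solve-∀
    cancel : ∀ a → a + + 4 * + 1 - + 4 ≡ a
    cancel = solve-∀

lucas⇒pell : (P : ℤ) → + 0 < P → P * P - + 4 ≢ + 0 →
  (n : ℕ) → LucasPseudoprime P (+ 1) n →
  (x y : ℤ) → Cong n (+ 2 * x) P → Cong n (+ 2 * y) (+ 1) →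
  PellPseudoprime (P * P - + 4) x y n
lucas⇒pell P _ _ n (odd , composite , _ , Uₖ≡0) x y 2x≡P 2y≡1 =
  odd , composite , toCong N≡1 , unit⇒gcd≡1 y (+ 2) y2≡1 , toCong yₖ≡0
  where
    open ≡mod-Reasoning n
    D = P * P - + 4
    k = idx D n
    N≡1 = halves-on-conic P x y odd (fromCong 2x≡P) (fromCong 2y≡1)
    y2≡1 : y * + 2 ≡ + 1 mod n
    y2≡1 = ≡mod-trans (≡mod-reflexive (ℤ.*-comm y (+ 2))) (fromCong 2y≡1)
    yₖ≡0 : proj₂ (bpow D (x , y) k) ≡ + 0 mod n
    yₖ≡0 = begin
      proj₂ (bpow D (x , y) k)        ≡⟨ proj₂-bpow D x y k ⟩
      y * U (+ 2 * x) (norm D x y) k  ≈⟨ *-congˡ y (U-cong (fromCong 2x≡P) N≡1 k) ⟩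
      y * U P (+ 1) k                 ≈⟨ *-congˡ y (fromCong Uₖ≡0) ⟩
      y * + 0                         ≡⟨ ℤ.*-zeroʳ y ⟩
      + 0                             ∎

pell⇒lucas : (D : ℤ) (n : ℕ) (x y : ℤ) → PellPseudoprime D x y n →
             LucasPseudoprime (+ 2 * x) (+ 1) n
pell⇒lucas D n x y (odd , composite , N≡1 , gcd≡1 , yₖ≡0) with gcd≡1⇒unit y gcd≡1
... | w , yw≡1 = odd , composite , gcd-zeroʳ (+ n) ,
  toCong (subst (λ j → U (+ 2 * x) (+ 1) j ≡ + 0 mod n) (sym same-index) Uₖ≡0)
  where
    open ≡mod-Reasoning n
    k = idx D n
    h = + (n ℕ./ 2) + + 1
    same-index : idx ((+ 2 * x) * (+ 2 * x) - + 4 * + 1) n ≡ k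
    same-index = cong (λ j → ∣ + n - j ∣)
      (jacobi-unit-square (+ 2 * y) (h * w) (*-unit (+ 2) h y w (odd⇒2-unit odd) yw≡1)
                          (lucas-discriminant D x y (fromCong N≡1)))
    yUₖ≡0 : y * U (+ 2 * x) (norm D x y) k ≡ y * + 0 mod n
    yUₖ≡0 = begin
      y * U (+ 2 * x) (norm D x y) k  ≡⟨ proj₂-bpow D x y k ⟨
      proj₂ (bpow D (x , y) k)        ≈⟨ fromCong yₖ≡0 ⟩
      + 0                             ≡⟨ ℤ.*-zeroʳ y ⟨
      y * + 0                         ∎
    Uₖ≡0 : U (+ 2 * x) (+ 1) k ≡ + 0 mod n
    Uₖ≡0 = begin
      U (+ 2 * x) (+ 1) k         ≈⟨ U-cong ≡mod-refl (fromCong N≡1) k ⟨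
      U (+ 2 * x) (norm D x y) k  ≈⟨ *-cancelˡ-unit y w yw≡1 yUₖ≡0 ⟩
      + 0                         ∎

theorem1 :
    ((P : ℤ) → + 0 < P → P * P - + 4 ≢ + 0 →
      (n : ℕ) → LucasPseudoprime P (+ 1) n →
      (x y : ℤ) → Cong n (+ 2 * x) P → Cong n (+ 2 * y) (+ 1) →
      PellPseudoprime (P * P - + 4) x y n)
    ×
    ((D : ℤ) (n : ℕ) (x y : ℤ) → PellPseudoprime D x y n →
      LucasPseudoprime (+ 2 * x) (+ 1) n)
theorem1 = lucas⇒pell , pell⇒lucas
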